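{- Let $G=(V,E)$ be a finite simple undirected graph with $n=|V|$, and consider the mixed-integer program $(F)$ defined in the context. Let $C\subseteq V$ be a set of vertices forming a clique in $G$ with $|C|\ge 2$, and let $L\subseteq\{1,\ldots,n\}$ be a set of labels with $|L|=|C|-1$. For a label $\ell$ write $d(\ell,L)=\min_{\ell'\in L}|\ell-\ell'|$. Then the inequality $$b-\sum_{c\in C}\sum_{1\le \ell\le n} d(\ell,L)\,x^{\ell}_c\le 0$$ is valid for $(F)$, i.e., it is satisfied by every feasible solution $(x,b)$ of $(F)$.
   Context: The mixed-integer program $(F)$ for a graph $G=(V,E)$ with $n=|V|$ has binary variables $x^\ell_i\in\{0,1\}$ for $i\in V$, $\ell\in\{1,\ldots,n\}$ (meaning vertex $i$ receives label $\ell$), and a real variable $b$. Its constraints are: $\sum_{i\in V}x^\ell_i=1$ for all $\ell\in\{1,\ldots,n\}$; $\sum_{\ell=1}^{n}x^\ell_i=1$ for all $i\in V$; and for every $\ell\in\{1,\ldots,n\}$ and every edge $\{i,i'\}\in E$: $$b-\sum_{1\le \ell'\le n}|\ell-\ell'|\,(x^{\ell'}_i+x^{\ell'}_{i'})\le 0.$$ The objective is to maximize $b$. An inequality is called valid for $(F)$ if every $(x,b)$ satisfying all constraints of $(F)$ (including integrality of $x$) satisfies it.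
   Formalization: The variable b of $(F)$ ranges over ℚ rather than over the reals. -}

module Defs where

open import Data.Nat using (ℕ; zero; suc; _+_; _*_; _⊓_; ∣_-_∣)
open import Data.Fin using (Fin; toℕ)
import Data.Fin as F
open import Data.Bool using (Bool; true; false; if_then_else_)
open import Data.Maybe using (Maybe; just; nothing; fromMaybe)
open import Data.Vec using (lookup; _∷_; [])
open import Data.Fin.Subset using (Subset; _∈_; ∣_∣)
open import Data.Integer using (+_)
open import Data.Rational using (ℚ; _/_; _≤_)
open import Relation.Nullary using (¬_)
open import Relation.Binary.PropositionalEquality using (_≡_; _≢_)

sumFin : ∀ {n} → (Fin n → ℕ) → ℕ
sumFin {zero}  f = 0
sumFin {suc n} f = f F.zero + sumFin (λ i → f (F.suc i))

ℕtoℚ : ℕ → ℚ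
ℕtoℚ m = (+ m) / 1

record Graph (n : ℕ) : Set₁ where
  field
    Adj       : Fin n → Fin n → Set
    symmetric : ∀ {i j} → Adj i j → Adj j i
    irreflex  : ∀ {i} → ¬ Adj i i

-- Labels {1,…,n} are represented by Fin n (label ℓ ↔ toℕ ℓ + 1);
-- |ℓ - ℓ'| is unaffected by this shift.
labelDist : ∀ {n} → Fin n → Fin n → ℕ
labelDist ℓ ℓ' = ∣ toℕ ℓ - toℕ ℓ' ∣

-- x i ℓ = true  iff  x^ℓ_i = 1 (binary variables)
Assignment : ℕ → Set
Assignment n = Fin n → Fin n → Bool

xval : ∀ {n} → Assignment n → Fin n → Fin n → ℕ
xval x i ℓ = if x i ℓ then 1 else 0

record Feasible {n : ℕ} (G : Graph n) (x : Assignment n) (b : ℚ) : Set where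
  field
    labelOnce  : ∀ (ℓ : Fin n) → sumFin (λ i → xval x i ℓ) ≡ 1
    vertexOnce : ∀ (i : Fin n) → sumFin (λ ℓ → xval x i ℓ) ≡ 1
    edgeBound  : ∀ (ℓ : Fin n) (i i' : Fin n) → Graph.Adj G i i' →
                 b ≤ ℕtoℚ (sumFin (λ ℓ' → labelDist ℓ ℓ' * (xval x i ℓ' + xval x i' ℓ')))

minOver : ∀ {n} → Subset n → (Fin n → ℕ) → Maybe ℕ
minOver {zero}  []       f = nothing
minOver {suc n} (s ∷ S) f with minOver S (λ i → f (F.suc i))
... | nothing = if s then just (f F.zero) else nothing
... | just m  = just (if s then f F.zero ⊓ m else m)

-- d(ℓ, L) = min_{ℓ' ∈ L} |ℓ - ℓ'|   (only used for nonempty L; 0 otherwise)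
dist : ∀ {n} → Fin n → Subset n → ℕ
dist ℓ L = fromMaybe 0 (minOver L (labelDist ℓ))

IsClique : ∀ {n} → Graph n → Subset n → Set
IsClique G C = ∀ {i j} → i ∈ C → j ∈ C → i ≢ j → Graph.Adj G i j

cliqueSum : ∀ {n} → Assignment n → Subset n → Subset n → ℕ
cliqueSum x C L =
  sumFin (λ c → if lookup C c then sumFin (λ ℓ → dist ℓ L * xval x c ℓ) else 0)

-- Every vertex i receives exactly one label π i. Give each c ∈ C a label of L nearest to π c;
-- as |L| < |C|, two distinct vertices c, c' of the clique share the same nearest label ℓ.
-- The edge constraint of (F) for {c, c'} at ℓ then reads
-- b ≤ |ℓ - π c| + |ℓ - π c'| = d(π c, L) + d(π c', L), which is at most the clique sum.
module Submission where

open import Defs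
open import Data.Nat using (ℕ; _≤_; _∸_)
open import Data.Fin.Subset using (Subset; ∣_∣)
open import Data.Rational using (ℚ)
import Data.Rational as Q
open import Relation.Binary.PropositionalEquality using (_≡_)

open import Data.Nat using (zero; suc; _+_; _*_; _<_; z≤n; s≤s)
import Data.Nat.Properties as ℕ
open import Data.Fin using (Fin; toℕ)
import Data.Fin as F
import Data.Fin.Properties as FinP
open import Data.Fin.Subset using (_∈_; Nonempty; Empty; _-_; inside; outside)
open import Data.Fin.Subset.Properties
  using (_∈?_; nonempty?; Empty-unique; ∣⊥∣≡0; x∈p∧x≢y⇒x∈p-y; x∈p⇒∣p-x∣<∣p∣)
open import Data.Bool using (Bool; true; false; if_then_else_)
open import Data.Maybe using (nothing; just; fromMaybe)
open import Data.Vec using (lookup; _∷_; []; here; there)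
open import Data.Vec.Properties using ([]=⇒lookup)
open import Data.Product using (_×_; _,_; proj₁; proj₂; ∃; ∃₂; ∃-syntax)
open import Data.Sum using (_⊎_; inj₁; inj₂)
open import Function using (_∘_)
open import Relation.Nullary using (yes; no; contradiction)
open import Relation.Nullary.Decidable using (_×-dec_)
open import Relation.Binary.PropositionalEquality
  using (_≢_; refl; sym; trans; cong; cong₂; subst; subst₂; module ≡-Reasoning)
import Data.Integer as ℤ
import Data.Integer.Properties as ℤP
import Data.Nat.Coprimality as Coprimality
import Data.Rational.Properties as ℚP
open import Algebra.Properties.CommutativeSemigroup ℕ.+-commutativeSemigroup using (interchange)

sumFin-cong : ∀ {n} {f g : Fin n → ℕ} → (∀ i → f i ≡ g i) → sumFin f ≡ sumFin g
sumFin-cong {zero}  f≗g = refl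
sumFin-cong {suc n} f≗g = cong₂ _+_ (f≗g F.zero) (sumFin-cong (f≗g ∘ F.suc))

sumFin-distrib-+ : ∀ {n} (f g : Fin n → ℕ) →
  sumFin (λ i → f i + g i) ≡ sumFin f + sumFin g
sumFin-distrib-+ {zero}  f g = refl
sumFin-distrib-+ {suc n} f g = begin
  f F.zero + g F.zero + sumFin (λ i → f (F.suc i) + g (F.suc i))
    ≡⟨ cong (f F.zero + g F.zero +_) (sumFin-distrib-+ (f ∘ F.suc) (g ∘ F.suc)) ⟩
  f F.zero + g F.zero + (sumFin (f ∘ F.suc) + sumFin (g ∘ F.suc))
    ≡⟨ interchange (f F.zero) (g F.zero) _ _ ⟩
  f F.zero + sumFin (f ∘ F.suc) + (g F.zero + sumFin (g ∘ F.suc)) ∎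
  where open ≡-Reasoning

term≤sumFin : ∀ {n} (f : Fin n → ℕ) i → f i ≤ sumFin f
term≤sumFin f F.zero    = ℕ.m≤m+n _ _
term≤sumFin f (F.suc i) = ℕ.≤-trans (term≤sumFin (f ∘ F.suc) i) (ℕ.m≤n+m _ (f F.zero))

twoTerms≤sumFin : ∀ {n} (f : Fin n → ℕ) {i j} → i ≢ j → f i + f j ≤ sumFin f
twoTerms≤sumFin f {F.zero}  {F.zero}  i≢j = contradiction refl i≢j
twoTerms≤sumFin f {F.zero}  {F.suc j} i≢j = ℕ.+-monoʳ-≤ (f F.zero) (term≤sumFin (f ∘ F.suc) j)
twoTerms≤sumFin f {F.suc i} {F.zero}  i≢j =
  subst (_≤ sumFin f) (ℕ.+-comm (f F.zero) _) (ℕ.+-monoʳ-≤ (f F.zero) (term≤sumFin (f ∘ F.suc) i))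
twoTerms≤sumFin f {F.suc i} {F.suc j} i≢j =
  ℕ.≤-trans (twoTerms≤sumFin (f ∘ F.suc) (i≢j ∘ cong F.suc)) (ℕ.m≤n+m _ (f F.zero))

indicator : Bool → ℕ
indicator b = if b then 1 else 0

sumFin-*-indicator≡0 : ∀ {n} (g : Fin n → Bool) → sumFin (indicator ∘ g) ≡ 0 →
  ∀ (f : Fin n → ℕ) → sumFin (λ i → f i * indicator (g i)) ≡ 0
sumFin-*-indicator≡0 {zero}  g _  f = refl
sumFin-*-indicator≡0 {suc n} g Σ≡0 f with g F.zero
... | false rewrite ℕ.*-zeroʳ (f F.zero) = sumFin-*-indicator≡0 (g ∘ F.suc) Σ≡0 (f ∘ F.suc)

sumFin-*-indicator≡1 : ∀ {n} (g : Fin n → Bool) → sumFin (indicator ∘ g) ≡ 1 →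
  ∃[ p ] ∀ (f : Fin n → ℕ) → sumFin (λ i → f i * indicator (g i)) ≡ f p
sumFin-*-indicator≡1 {suc n} g Σ≡1 with g F.zero
... | true = F.zero , λ f → begin
  f F.zero * 1 + sumFin (λ i → f (F.suc i) * indicator (g (F.suc i)))
    ≡⟨ cong₂ _+_ (ℕ.*-identityʳ (f F.zero))
             (sumFin-*-indicator≡0 (g ∘ F.suc) (ℕ.suc-injective Σ≡1) (f ∘ F.suc)) ⟩
  f F.zero + 0
    ≡⟨ ℕ.+-identityʳ (f F.zero) ⟩
  f F.zero ∎
  where open ≡-Reasoning
... | false with sumFin-*-indicator≡1 (g ∘ F.suc) Σ≡1
...   | p , select = F.suc p , λ f →
  trans (cong (_+ sumFin (λ i → f (F.suc i) * indicator (g (F.suc i)))) (ℕ.*-zeroʳ (f F.zero)))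
        (select (f ∘ F.suc))

0<∣p∣⇒Nonempty : ∀ {n} (p : Subset n) → 0 < ∣ p ∣ → Nonempty p
0<∣p∣⇒Nonempty {n} p 0<∣p∣ with nonempty? p
... | yes p≠∅ = p≠∅
... | no  p=∅ = contradiction (trans (cong ∣_∣ (Empty-unique p=∅)) (∣⊥∣≡0 n)) (ℕ.>⇒≢ 0<∣p∣)

subset-pigeonhole : ∀ {a b} (C : Subset a) (L : Subset b) (φ : Fin a → Fin b) →
  (∀ {c} → c ∈ C → φ c ∈ L) → ∣ L ∣ < ∣ C ∣ →
  ∃₂ λ c c' → c ∈ C × c' ∈ C × c ≢ c' × φ c ≡ φ c'
subset-pigeonhole (outside ∷ C) L φ φ∈L ∣L∣<∣C∣
  with subset-pigeonhole C L (φ ∘ F.suc) (φ∈L ∘ there) ∣L∣<∣C∣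
... | c , c' , c∈C , c'∈C , c≢c' , φc≡φc' =
  F.suc c , F.suc c' , there c∈C , there c'∈C , c≢c' ∘ FinP.suc-injective , φc≡φc'
subset-pigeonhole (inside ∷ C) L φ φ∈L ∣L∣<∣C∣
  with FinP.any? (λ c → (c ∈? C) ×-dec (φ (F.suc c) FinP.≟ φ F.zero))
... | yes (c , c∈C , φc≡φ0) = F.zero , F.suc c , here , there c∈C , (λ ()) , sym φc≡φ0
... | no  noCollision
  with subset-pigeonhole C (L - φ F.zero) (φ ∘ F.suc)
         (λ c∈C → x∈p∧x≢y⇒x∈p-y (φ∈L (there c∈C)) (λ φc≡φ0 → noCollision (_ , c∈C , φc≡φ0)))
         (ℕ.<-≤-trans (x∈p⇒∣p-x∣<∣p∣ (φ∈L here)) (ℕ.≤-pred ∣L∣<∣C∣))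
...   | c , c' , c∈C , c'∈C , c≢c' , φc≡φc' =
  F.suc c , F.suc c' , there c∈C , there c'∈C , c≢c' ∘ FinP.suc-injective , φc≡φc'

minOver-attained : ∀ {n} (S : Subset n) (f : Fin n → ℕ) →
  (Empty S × minOver S f ≡ nothing) ⊎ (∃[ j ] j ∈ S × minOver S f ≡ just (f j))
minOver-attained []      f = inj₁ ((λ ()) , refl)
minOver-attained (s ∷ S) f with minOver S (f ∘ F.suc) | minOver-attained S (f ∘ F.suc)
... | nothing | inj₂ (_ , _ , ())
... | just _  | inj₁ (_ , ())
minOver-attained (inside  ∷ S) f | nothing | inj₁ _ = inj₂ (F.zero , here , refl)
minOver-attained (outside ∷ S) f | nothing | inj₁ (S=∅ , _) = inj₁ (empty , refl)
  where
  empty : Empty (outside ∷ S)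
  empty (F.suc j , there j∈S) = S=∅ (j , j∈S)
minOver-attained (outside ∷ S) f | just _ | inj₂ (j , j∈S , refl) =
  inj₂ (F.suc j , there j∈S , refl)
minOver-attained (inside  ∷ S) f | just _ | inj₂ (j , j∈S , refl)
  with ℕ.⊓-sel (f F.zero) (f (F.suc j))
... | inj₁ min≡f0 = inj₂ (F.zero , here , cong just min≡f0)
... | inj₂ min≡fj = inj₂ (F.suc j , there j∈S , cong just min≡fj)

dist-attained : ∀ {n} {L : Subset n} → Nonempty L → ∀ ℓ →
  ∃[ j ] j ∈ L × dist ℓ L ≡ labelDist j ℓ
dist-attained {L = L} L≠∅ ℓ with minOver-attained L (labelDist ℓ)
... | inj₁ (L=∅ , _) = contradiction L≠∅ L=∅
... | inj₂ (j , j∈L , min≡) =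
  j , j∈L , trans (cong (fromMaybe 0) min≡) (ℕ.∣-∣-comm (toℕ ℓ) (toℕ j))

ℕtoℚ≡mkℚ : ∀ m → ℕtoℚ m ≡ Q.mkℚ (ℤ.+ m) 0 (Coprimality.sym (Coprimality.1-coprimeTo m))
ℕtoℚ≡mkℚ m = ℚP.normalize-coprime (Coprimality.sym (Coprimality.1-coprimeTo m))

ℕtoℚ-mono-≤ : ∀ {m k} → m ≤ k → ℕtoℚ m Q.≤ ℕtoℚ k
ℕtoℚ-mono-≤ {m} {k} m≤k rewrite ℕtoℚ≡mkℚ m | ℕtoℚ≡mkℚ k =
  Q.*≤* (subst₂ ℤ._≤_ (sym (ℤP.*-identityʳ (ℤ.+ m))) (sym (ℤP.*-identityʳ (ℤ.+ k))) (ℤ.+≤+ m≤k))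

module _ {n} (x : Assignment n) (vertexOnce : ∀ i → sumFin (xval x i) ≡ 1) where

  label : Fin n → Fin n
  label i = proj₁ (sumFin-*-indicator≡1 (x i) (vertexOnce i))

  sumFin-*-xval : ∀ i (f : Fin n → ℕ) → sumFin (λ ℓ → f ℓ * xval x i ℓ) ≡ f (label i)
  sumFin-*-xval i = proj₂ (sumFin-*-indicator≡1 (x i) (vertexOnce i))

  edgeCost≡ : ∀ ℓ i i' →
    sumFin (λ ℓ' → labelDist ℓ ℓ' * (xval x i ℓ' + xval x i' ℓ'))
      ≡ labelDist ℓ (label i) + labelDist ℓ (label i')
  edgeCost≡ ℓ i i' = begin
    sumFin (λ ℓ' → labelDist ℓ ℓ' * (xval x i ℓ' + xval x i' ℓ'))
      ≡⟨ sumFin-cong (λ ℓ' → ℕ.*-distribˡ-+ (labelDist ℓ ℓ') (xval x i ℓ') (xval x i' ℓ')) ⟩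
    sumFin (λ ℓ' → labelDist ℓ ℓ' * xval x i ℓ' + labelDist ℓ ℓ' * xval x i' ℓ')
      ≡⟨ sumFin-distrib-+ (λ ℓ' → labelDist ℓ ℓ' * xval x i ℓ')
                          (λ ℓ' → labelDist ℓ ℓ' * xval x i' ℓ') ⟩
    sumFin (λ ℓ' → labelDist ℓ ℓ' * xval x i ℓ') + sumFin (λ ℓ' → labelDist ℓ ℓ' * xval x i' ℓ')
      ≡⟨ cong₂ _+_ (sumFin-*-xval i (labelDist ℓ)) (sumFin-*-xval i' (labelDist ℓ)) ⟩
    labelDist ℓ (label i) + labelDist ℓ (label i') ∎
    where open ≡-Reasoning

  twoMembers≤cliqueSum : ∀ {C} L {c c'} → c ∈ C → c' ∈ C → c ≢ c' →
    dist (label c) L + dist (label c') L ≤ cliqueSum x C L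
  twoMembers≤cliqueSum {C} L {c} {c'} c∈C c'∈C c≢c' = begin
    dist (label c) L + dist (label c') L
      ≡⟨ sym (cong₂ _+_ (atMember c∈C) (atMember c'∈C)) ⟩
    distToL c + distToL c'
      ≤⟨ twoTerms≤sumFin distToL c≢c' ⟩
    sumFin distToL
      ≡⟨ sumFin-cong (λ i →
           cong (if lookup C i then_else 0) (sym (sumFin-*-xval i (λ ℓ → dist ℓ L)))) ⟩
    cliqueSum x C L ∎
    where
    open ℕ.≤-Reasoning
    distToL : Fin n → ℕ
    distToL i = if lookup C i then dist (label i) L else 0
    atMember : ∀ {i} → i ∈ C → distToL i ≡ dist (label i) L
    atMember i∈C = cong (if_then _ else 0) ([]=⇒lookup i∈C)


  sharedNearestLabel : ∀ (C L : Subset n) → Nonempty L → ∣ L ∣ < ∣ C ∣ →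
    ∃₂ λ c c' → c ∈ C × c' ∈ C × c ≢ c' × ∃ λ ℓ →
      dist (label c) L ≡ labelDist ℓ (label c) × dist (label c') L ≡ labelDist ℓ (label c')
  sharedNearestLabel C L L≠∅ ∣L∣<∣C∣ =
    let c , c' , c∈C , c'∈C , c≢c' , sameNearest =
          subset-pigeonhole C L nearest (λ {c} _ → nearest∈L c) ∣L∣<∣C∣
    in c , c' , c∈C , c'∈C , c≢c' , nearest c , dist≡ c ,
       trans (dist≡ c') (cong (λ ℓ → labelDist ℓ (label c')) (sym sameNearest))
    where
    nearest : Fin n → Fin n
    nearest c = proj₁ (dist-attained L≠∅ (label c))
    nearest∈L : ∀ c → nearest c ∈ L
    nearest∈L c = proj₁ (proj₂ (dist-attained L≠∅ (label c)))
    dist≡ : ∀ c → dist (label c) L ≡ labelDist (nearest c) (label c)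
    dist≡ c = proj₂ (proj₂ (dist-attained L≠∅ (label c)))

mainTheorem1 : ∀ {n : ℕ} (G : Graph n) (C L : Subset n) →
    IsClique G C → 2 ≤ ∣ C ∣ → ∣ L ∣ ≡ ∣ C ∣ ∸ 1 →
    ∀ (x : Assignment n) (b : ℚ) → Feasible G x b →
    b Q.≤ ℕtoℚ (cliqueSum x C L)
mainTheorem1 G C L isClique 2≤∣C∣ ∣L∣≡∣C∣-1 x b feasible =
  let c , c' , c∈C , c'∈C , c≢c' , ℓ , dist≡ , dist≡′ =
        sharedNearestLabel x vertexOnce C L L≠∅ ∣L∣<∣C∣
      b≤edgeCost = subst (λ cost → b Q.≤ ℕtoℚ cost) (edgeCost≡ x vertexOnce ℓ c c')
                     (edgeBound ℓ c c' (isClique c∈C c'∈C c≢c'))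
      edgeCost≤cliqueSum = subst (_≤ cliqueSum x C L) (cong₂ _+_ dist≡ dist≡′)
                             (twoMembers≤cliqueSum x vertexOnce L c∈C c'∈C c≢c')
  in ℚP.≤-trans b≤edgeCost (ℕtoℚ-mono-≤ edgeCost≤cliqueSum)
  where
  open Feasible feasible
  ∣L∣<∣C∣ : ∣ L ∣ < ∣ C ∣
  ∣L∣<∣C∣ = subst (_< ∣ C ∣) (sym ∣L∣≡∣C∣-1) (ℕ.∸-monoʳ-< {o = 0} (s≤s z≤n) (ℕ.<⇒≤ 2≤∣C∣))
  L≠∅ : Nonempty L
  L≠∅ = 0<∣p∣⇒Nonempty L (subst (0 <_) (sym ∣L∣≡∣C∣-1) (ℕ.∸-monoˡ-≤ 1 2≤∣C∣))
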